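{- Let $d\in\mathbb{N}$ and let $f:\mathbb{N}^d\to\mathbb{N}$ be a function. Suppose that there exists $C\in\mathbb{N}$ such that $$f(n_1,\ldots,n_d)<\max\{n_1,\ldots,n_d\}$$ for all $n_1,\ldots,n_d\in\mathbb{N}$ with $n_i\ge C$ for some $i\in\{1,\ldots,d\}$. Let $(x_n)_{n\ge1}$ be a sequence of positive integers with arbitrary starting values $x_1,\ldots,x_d\in\mathbb{N}$ satisfying $x_{n+d}=f(x_n,\ldots,x_{n+d-2},x_{n+d-1})$ for all $n\in\mathbb{N}$. Then $$\limsup_{n\to\infty}x_n\le\max\{f(n_1,\ldots,n_d): n_1,\ldots,n_d\le C-1\}.$$ In particular, $(x_n)_{n\ge1}$ is bounded above, hence eventually periodic (i.e., there exists $T\in\mathbb{N}$ with $x_{n+T}=x_n$ for all sufficiently large $n$).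
   Context: $\mathbb{N}$ denotes the set of positive integers. -}

module Defs where

open import Data.Nat using (ℕ; zero; suc; _+_; _∸_; _⊔_; _≤_)
open import Data.Nat.Properties using ()
open import Data.Fin using (Fin; toℕ)
open import Data.List using (List; []; _∷_; map; foldr; upTo)
open import Data.Vec using (Vec; []; _∷_; tabulate)

vmax : ∀ {d} → Vec ℕ d → ℕ
vmax []       = 0
vmax (x ∷ xs) = x ⊔ vmax xs

lmax : List ℕ → ℕ
lmax = foldr _⊔_ 0

range1 : ℕ → List ℕ
range1 C = map suc (upTo (C ∸ 1))

-- maxBelow d C f = max { f (n₁,…,n_d) : 1 ≤ nᵢ ≤ C-1 }
-- (0 if the index set is empty, i.e. d ≥ 1 and C ≤ 1)
maxBelow : (d : ℕ) → ℕ → (Vec ℕ d → ℕ) → ℕ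
maxBelow zero    C f = f []
maxBelow (suc d) C f = lmax (map (λ k → maxBelow d C (λ v → f (k ∷ v))) (range1 C))

window : (d : ℕ) → (ℕ → ℕ) → ℕ → Vec ℕ d
window d x n = tabulate (λ i → x (n + toℕ i))

-- Windows of d consecutive terms whose maximum V exceeds B := maxBelow d C f
-- cannot persist: by the hypothesis on f every new term is < V (or ≤ B < V),
-- so after d steps the window maximum has dropped to V - 1, and once it is
-- ≤ B it stays ≤ B.  A sequence bounded by B has at most (B+1)^d windows, so
-- by pigeonhole two windows coincide, and since each term is a function of
-- the previous window the sequence is periodic from then on.
module Submission where

open import Defs
open import Data.Nat using (ℕ; zero; suc; _+_; _∸_; _^_; _⊔_; _≤_; _<_; z≤n; s≤s; _≤?_; _<?_; s≤s⁻¹)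
open import Data.Nat.Properties
open import Data.Fin using (Fin; toℕ; fromℕ<)
open import Data.Fin.Base using (finToFun; funToFin)
open import Data.Fin.Properties using (toℕ<n; toℕ-fromℕ<; fromℕ<-injective; finToFun-funToFin; pigeonhole)
open import Data.Vec using (Vec; []; _∷_)
open import Data.Vec.Properties using (tabulate-cong)
open import Data.Vec.Relation.Unary.All as All using (All; []; _∷_)
open import Data.Vec.Relation.Unary.All.Properties using (tabulate⁺)
open import Data.Vec.Relation.Unary.Any using (Any; here; there; any?)
open import Data.List using (List; _∷_)
open import Data.List.Membership.Propositional using (_∈_)
open import Data.List.Membership.Propositional.Properties using (∈-map⁺; ∈-upTo⁺)
import Data.List.Relation.Unary.Any as ListAny
open import Data.Product using (_×_; ∃; _,_; proj₂)
open import Data.Sum using (_⊎_; inj₁; inj₂; [_,_])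
open import Function using (_∘_; id)
open import Relation.Nullary using (¬_; yes; no; contradiction)
open import Relation.Binary.PropositionalEquality using (_≡_; refl; sym; trans; cong; subst; module ≡-Reasoning)

¬Any⇒All¬ : ∀ {A : Set} {P : A → Set} {n} (v : Vec A n) → ¬ Any P v → All (¬_ ∘ P) v
¬Any⇒All¬ []      _  = []
¬Any⇒All¬ (a ∷ v) ¬p = (¬p ∘ here) ∷ ¬Any⇒All¬ v (¬p ∘ there)

vmax-lub : ∀ {n V} (v : Vec ℕ n) → All (_≤ V) v → vmax v ≤ V
vmax-lub []      []       = z≤n
vmax-lub (a ∷ v) (p ∷ ps) = ⊔-lub p (vmax-lub v ps)

lmax-upper : ∀ {a} {xs : List ℕ} → a ∈ xs → a ≤ lmax xs
lmax-upper {xs = y ∷ _} (ListAny.here refl) = m≤m⊔n y _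
lmax-upper {xs = y ∷ _} (ListAny.there p)   = m≤n⇒m≤o⊔n y (lmax-upper p)

∈-range1 : ∀ {a C} → 1 ≤ a → a < C → a ∈ range1 C
∈-range1 {suc a} _ a<C = ∈-map⁺ suc (∈-upTo⁺ (∸-monoˡ-≤ 1 a<C))

maxBelow-upper : ∀ d C (f : Vec ℕ d → ℕ) (v : Vec ℕ d) →
                 All (λ a → 1 ≤ a × a < C) v → f v ≤ maxBelow d C f
maxBelow-upper zero    C f []      []             = ≤-refl
maxBelow-upper (suc d) C f (a ∷ v) ((1≤a , a<C) ∷ ps) =
  ≤-trans (maxBelow-upper d C (f ∘ (a ∷_)) v ps)
          (lmax-upper (∈-map⁺ (λ k → maxBelow d C (f ∘ (k ∷_))) (∈-range1 1≤a a<C)))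

+-swapʳ : ∀ a b c → a + b + c ≡ a + c + b
+-swapʳ a b c = trans (+-assoc a b c) (trans (cong (a +_) (+-comm b c)) (sym (+-assoc a c b)))

OnWindow : ℕ → (ℕ → Set) → ℕ → Set
OnWindow d P n = ∀ t → t < d → P (n + t)

window-bounded : ∀ d (x : ℕ → ℕ) n → ∃ λ V → OnWindow d (λ m → x m ≤ V) n
window-bounded zero    x n = 0 , λ _ ()
window-bounded (suc d) x n with window-bounded d x n
... | V , below = V ⊔ x (n + d) , bound
  where
  bound : OnWindow (suc d) (λ m → x m ≤ V ⊔ x (n + d)) n
  bound t t<1+d with m<1+n⇒m<n∨m≡n t<1+d
  ... | inj₁ t<d  = m≤n⇒m≤n⊔o (x (n + d)) (below t t<d)
  ... | inj₂ refl = m≤n⊔m V (x (n + t))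

module _ {d} {P : ℕ → Set} (step : ∀ m → OnWindow d P m → P (m + d)) where

  window-slide : ∀ {n} → OnWindow d P n → OnWindow d P (suc n)
  window-slide {n} w t t<d with suc t <? d
  ... | yes 1+t<d = subst P (+-suc n t) (w (suc t) 1+t<d)
  ... | no  1+t≮d = subst P (trans (cong (n +_) d≡1+t) (+-suc n t)) (step n w)
    where
    d≡1+t : d ≡ suc t
    d≡1+t = ≤-antisym (≮⇒≥ 1+t≮d) t<d

  window-induction : 1 ≤ d → ∀ {n} → OnWindow d P n → ∀ m → n ≤ m → P m
  window-induction 1≤d {n} w m n≤m =
    subst P (trans (+-identityʳ _) (m∸n+n≡m n≤m)) (slides (m ∸ n) 0 1≤d)
    where
    slides : ∀ k → OnWindow d P (k + n)
    slides zero    = w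
    slides (suc k) = window-slide (slides k)

-- Base-(B+1) digits of a bounded word of length d.
encode : ∀ {d B} (v : ℕ → ℕ) → (∀ t → t < d → v t ≤ B) → Fin (suc B ^ d)
encode v v≤B = funToFin (λ i → fromℕ< (s≤s (v≤B (toℕ i) (toℕ<n i))))

encode-injective : ∀ {d B} (u v : ℕ → ℕ) (u≤B : ∀ t → t < d → u t ≤ B) (v≤B : ∀ t → t < d → v t ≤ B) →
                   encode u u≤B ≡ encode v v≤B → ∀ t → t < d → u t ≡ v t
encode-injective u v u≤B v≤B same t t<d =
  subst (λ s → u s ≡ v s) (toℕ-fromℕ< t<d)
    (fromℕ<-injective _ _ _ _ (begin
      fromℕ< (s≤s (u≤B s s<d))  ≡⟨ sym (finToFun-funToFin _ i) ⟩
      finToFun (encode u u≤B) i ≡⟨ cong (λ c → finToFun c i) same ⟩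
      finToFun (encode v v≤B) i ≡⟨ finToFun-funToFin _ i ⟩
      fromℕ< (s≤s (v≤B s s<d))  ∎))
  where
  open ≡-Reasoning
  i = fromℕ< t<d
  s = toℕ i
  s<d = toℕ<n i

EventuallyBelow : (ℕ → ℕ) → ℕ → Set
EventuallyBelow x B = ∃ λ N → (n : ℕ) → N ≤ n → x n ≤ B

EventuallyPeriodic : (ℕ → ℕ) → Set
EventuallyPeriodic x = ∃ λ T → 1 ≤ T × (∃ λ N → (n : ℕ) → N ≤ n → x (n + T) ≡ x n)

module Recurrence {d} (1≤d : 1 ≤ d) (F : Vec ℕ d → ℕ) (x : ℕ → ℕ)
                  (rec : (n : ℕ) → x (n + d) ≡ F (window d x n)) where

  periodic-from-window : ∀ a T → OnWindow d (λ n → x (n + T) ≡ x n) a →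
                         ∀ n → a ≤ n → x (n + T) ≡ x n
  periodic-from-window a T = window-induction step 1≤d
    where
    step : ∀ m → OnWindow d (λ n → x (n + T) ≡ x n) m → x (m + d + T) ≡ x (m + d)
    step m w = begin
      x (m + d + T)          ≡⟨ cong x (+-swapʳ m d T) ⟩
      x (m + T + d)          ≡⟨ rec (m + T) ⟩
      F (window d x (m + T)) ≡⟨ cong F (tabulate-cong λ i →
                                  trans (cong x (+-swapʳ m T (toℕ i))) (w (toℕ i) (toℕ<n i))) ⟩
      F (window d x m)       ≡⟨ sym (rec m) ⟩
      x (m + d)              ∎
      where open ≡-Reasoning

  module _ {B N} (below : (n : ℕ) → N ≤ n → x n ≤ B) where

    private
      bounded-after : ∀ k → OnWindow d (λ n → x n ≤ B) (N + k)
      bounded-after k t _ = below _ (≤-trans (m≤m+n N k) (m≤m+n _ t))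

      code : ℕ → Fin (suc B ^ d)
      code k = encode {d} (λ t → x (N + k + t)) (bounded-after k)

    eventually-periodic : EventuallyPeriodic x
    eventually-periodic with pigeonhole (n<1+n (suc B ^ d)) (code ∘ toℕ)
    ... | i , j , i<j , same = T , m<n⇒0<n∸m i<j , a , periodic-from-window a T repeats
      where
      a T : ℕ
      a = N + toℕ i
      T = toℕ j ∸ toℕ i
      a+T≡b : a + T ≡ N + toℕ j
      a+T≡b = trans (+-assoc N (toℕ i) T) (cong (N +_) (m+[n∸m]≡n (<⇒≤ i<j)))
      repeats : OnWindow d (λ n → x (n + T) ≡ x n) a
      repeats t t<d = trans (cong x (trans (+-swapʳ a t T) (cong (_+ t) a+T≡b)))
        (sym (encode-injective _ _ (bounded-after (toℕ i)) (bounded-after (toℕ j)) same t t<d))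

module Descent {d} (1≤d : 1 ≤ d) (f : Vec ℕ d → ℕ) (C : ℕ)
               (shrinks : (v : Vec ℕ d) → All (1 ≤_) v → Any (C ≤_) v → f v < vmax v)
               (x : ℕ → ℕ) (positive : (n : ℕ) → 1 ≤ x n)
               (rec : (n : ℕ) → x (n + d) ≡ f (window d x n)) where

  B : ℕ
  B = maxBelow d C f

  BoundedWindow : ℕ → ℕ → Set
  BoundedWindow V = OnWindow d (λ m → x m ≤ V)

  window-all : ∀ {P : ℕ → Set} {m} → OnWindow d (P ∘ x) m → All P (window d x m)
  window-all w = tabulate⁺ λ i → w (toℕ i) (toℕ<n i)

  window-positive : ∀ m → All (1 ≤_) (window d x m)
  window-positive m = window-all (λ t _ → positive (m + t))

  next-below : ∀ m V → BoundedWindow V m → x (m + d) < V ⊎ x (m + d) ≤ B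
  next-below m V w rewrite rec m with any? (C ≤?_) (window d x m)
  ... | yes large = inj₁ (<-≤-trans (shrinks _ (window-positive m) large) (vmax-lub _ (window-all w)))
  ... | no ¬large = inj₂ (maxBelow-upper d C f _
                           (All.zip (window-positive m , All.map ≰⇒> (¬Any⇒All¬ _ ¬large))))

  bound-persists : ∀ {V n} → B ≤ V → BoundedWindow V n → ∀ m → n ≤ m → x m ≤ V
  bound-persists {V} B≤V =
    window-induction (λ m w → [ <⇒≤ , (λ p → ≤-trans p B≤V) ] (next-below m V w)) 1≤d

  bound-drops : ∀ {V n} → B < suc V → BoundedWindow (suc V) n → BoundedWindow V (n + d)
  bound-drops {V} {n} B<1+V w t t<d =
    subst (λ k → x k ≤ V) (+-swapʳ n t d)
      (s≤s⁻¹ ([ id , (λ p → ≤-<-trans p B<1+V) ] (next-below (n + t) (suc V) later)))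
    where
    later : BoundedWindow (suc V) (n + t)
    later s _ = bound-persists (<⇒≤ B<1+V) w (n + t + s) (≤-trans (m≤m+n n t) (m≤m+n _ s))

  eventually-below : ∀ V n → BoundedWindow V n → EventuallyBelow x B
  eventually-below V n w with V ≤? B
  ... | yes V≤B = n , bound-persists ≤-refl (λ t t<d → ≤-trans (w t t<d) V≤B)
  eventually-below zero    n w | no 0≰B = contradiction z≤n 0≰B
  eventually-below (suc V) n w | no V≰B = eventually-below V (n + d) (bound-drops (≰⇒> V≰B) w)

proposition1p1 :
    (d : ℕ) → 1 ≤ d →
    (f : Vec ℕ d → ℕ) →
    ((v : Vec ℕ d) → All (1 ≤_) v → 1 ≤ f v) →
    (C : ℕ) → 1 ≤ C →
    ((v : Vec ℕ d) → All (1 ≤_) v → Any (C ≤_) v → f v < vmax v) →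
    (x : ℕ → ℕ) →
    ((n : ℕ) → 1 ≤ x n) →
    ((n : ℕ) → x (n + d) ≡ f (window d x n)) →
    (∃ λ N → (n : ℕ) → N ≤ n → x n ≤ maxBelow d C f)
      × (∃ λ T → 1 ≤ T × (∃ λ N → (n : ℕ) → N ≤ n → x (n + T) ≡ x n))
proposition1p1 d 1≤d f _ C _ shrinks x positive rec =
  eventually-bounded , Recurrence.eventually-periodic 1≤d f x rec (proj₂ eventually-bounded)
  where
  eventually-bounded : EventuallyBelow x (maxBelow d C f)
  eventually-bounded with window-bounded d x 0
  ... | V , w = Descent.eventually-below 1≤d f C shrinks x positive rec V 0 w
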